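{- For every typing context $\Delta=x_1:A_1,\dots,x_n:A_n$ of $\mathrm{CP}+\mathrm{Mix}_0+\mathrm{Mix}_2$ and every set $X\subseteq[\![\Delta]\!]$, $[\![\mathcal{T}_\Delta[-]\vdash\Delta\Rightarrow\Delta^{L\bot},z:\mathbf{1}]\!](X)=F_\Delta(X)$.
   Context: CP processes and typing: types $A::=\mathbf{1}\mid\bot\mid A\otimes B\mid A⅋B\mid A\oplus B\mid A\&B\mid !A\mid ?A$ with usual linear duality; typing rules: $x\leftrightarrow y\vdash x:A,y:A^\bot$; $x[]\vdash x:\mathbf{1}$; $x().P$ adds $x:\bot$; $\overline{x}[y].(P\mid Q)\vdash\Gamma,\Delta,x:A\otimes B$ from $P\vdash\Gamma,y:A$, $Q\vdash\Delta,x:B$; $x(y).P\vdash\Gamma,x:A⅋B$ from $P\vdash\Gamma,y:A,x:B$; $x.i;P\vdash\Gamma,x:A_1\oplus A_2$ from $P\vdash\Gamma,x:A_i$; $x.\mathrm{case}(P,Q)\vdash\Gamma,x:A_1\&A_2$; $!x(y).P\vdash ?\Delta,x:!A$ from $P\vdash ?\Delta,y:A$; $?x[y].P\vdash\Delta,x:?A$ from $P\vdash\Delta,y:A$; contraction and weakening on $?$-types; cut $(\nu x)(P\mid Q)\vdash\Gamma,\Delta$ from $P\vdash\Gamma,x:A$, $Q\vdash\Delta,x:A^\bot$; $0\vdash\cdot$; mix $P\mid Q\vdash\Gamma,\Delta$. Denotations: $[\![\mathbf{1}]\!]=[\![\bot]\!]=\{*\}$, $[\![A\otimes B]\!]=[\![A⅋B]\!]=[\![A]\!]\times[\![B]\!]$,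 $[\![A_1\oplus A_2]\!]=[\![A_1\&A_2]\!]=\{(i,a)\mid a\in[\![A_i]\!]\}$, $[\![!A]\!]=[\![?A]\!]$ = finite multisets over $[\![A]\!]$; $[\![x_1:A_1,\dots,x_n:A_n]\!]=\prod_i[\![A_i]\!]$; process denotations $[\![P\vdash\Gamma]\!]\subseteq[\![\Gamma]\!]$: forwarder $\{(a,a)\}$; $x[]$: $\{(*)\}$; $0$: $\{()\}$; $x().P$: $\{(\gamma,*)\}$; cut: $\{(\gamma,\delta)\mid\exists a.(\gamma,a)\in[\![P]\!],(\delta,a)\in[\![Q]\!]\}$; output: $\{(\gamma,\delta,(a,b))\mid(\gamma,a)\in[\![P]\!],(\delta,b)\in[\![Q]\!]\}$; input: $\{(\gamma,(a,b))\mid(\gamma,a,b)\in[\![P]\!]\}$; selection $\{(\gamma,(i,a))\mid(\gamma,a)\in[\![P]\!]\}$; branching $\bigcup_i\{(\gamma,(i,a))\mid(\gamma,a)\in[\![P_i]\!]\}$; server: $\{(\biguplus_{j=1}^k\alpha^1_j,\dots,\biguplus_{j=1}^k\alpha^n_j,\langle a_1,\dots,a_k\rangle)\mid k\ge0,\forall j.(\alpha^1_j,\dots,\alpha^n_j,a_j)\in[\![P]\!]\}$; client $\{(\gamma,\langle a\rangle)\mid(\gamma,a)\in[\![P]\!]\}$; weakening $\{(\gamma,\emptyset)\}$; contraction $\{(\gamma,\alpha_1\uplus\alpha_2)\mid(\gamma,\alpha_1,\alpha_2)\in[\![P]\!]\}$; mix: product. Typed contexts $K\vdash\Sigma\Rightarrow\Gamma$: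 $[-]\vdash\Sigma\Rightarrow\Sigma$; $(\nu x)(K\mid Q)\vdash\Sigma\Rightarrow\Gamma,\Delta$ from $K\vdash\Sigma\Rightarrow\Gamma,x:A$, $Q\vdash\Delta,x:A^\bot$; $K\mid P\vdash\Sigma\Rightarrow\Gamma,\Delta$ from $K\vdash\Sigma\Rightarrow\Gamma$, $P\vdash\Delta$. $[\![K]\!]:\mathcal{P}([\![\Sigma]\!])\to\mathcal{P}([\![\Gamma]\!])$: $[\![[-]]\!](X)=X$; $[\![(\nu x)(K\mid Q)]\!](X)=\{(\sigma,\gamma)\mid\exists a.(\sigma,a)\in[\![K]\!](X),(\gamma,a)\in[\![Q]\!]\}$; $[\![K\mid Q]\!](X)=\{(\sigma,\gamma)\mid\sigma\in[\![K]\!](X),\gamma\in[\![Q]\!]\}$. Translation: $\bot^{L\bot}=\bot$; $\mathbf{1}^{L\bot}=\mathbf{1}\otimes\bot$; $(A\otimes B)^{L\bot}=((A^{L\bot}⅋\mathbf{1})\otimes(B^{L\bot}⅋\mathbf{1}))\otimes\bot$; $(A⅋B)^{L\bot}=A^{L\bot}⅋B^{L\bot}$; $(A\oplus B)^{L\bot}=((A^{L\bot}⅋\mathbf{1})\oplus(B^{L\bot}⅋\mathbf{1}))\otimes\bot$; $(A\&B)^{L\bot}=A^{L\bot}\&B^{L\bot}$; $(!A)^{L\bot}=!(A^{L\bot}⅋\mathbf{1})\otimes\bot$; $(?A)^{L\bot}=?((A^{L\bot}⅋\mathbf{1})\otimes\bot)$; $\Delta^{L\bot}=y_1:A_1^{L\bot},\dots,y_n:A_n^{L\bot}$.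 $F_A$: $F_\bot(*)=*$; $F_{\mathbf{1}}(*)=(*,*)$; $F_{A⅋B}(a,b)=(F_A(a),F_B(b))$; $F_{A\otimes B}(a,b)=(((F_A(a),*),(F_B(b),*)),*)$; $F_{A_1\&A_2}(i,a)=(i,F_{A_i}(a))$; $F_{A_1\oplus A_2}(i,a)=((i,(F_{A_i}(a),*)),*)$; $F_{!A}(\langle a_1..a_k\rangle)=(\langle(F_A(a_1),*),\dots,(F_A(a_k),*)\rangle,*)$; $F_{?A}(\langle a_1..a_k\rangle)=\langle((F_A(a_1),*),*),\dots\rangle$; $F_\Delta(a_1,\dots,a_n)=(F_{A_1}(a_1),\dots,F_{A_n}(a_n),*)$, extended to sets pointwise. Transformers $T^A_{x,x'}\vdash x:A^\bot,x':A^{L\bot}$: $T^\bot_{x,x'}=x\leftrightarrow x'$; $T^{\mathbf{1}}_{x,x'}=\overline{x'}[y].(y\leftrightarrow x\mid x'().0)$; $T^{A\otimes B}_{x,z}=x(y).\overline{z}[z_2].(\overline{z_2}[z_1].(z_1(y').(T^A_{y,y'}\mid z_1[])\mid z_2(x').(T^B_{x,x'}\mid z_2[]))\mid z().0)$; $T^{A⅋B}_{x,x'}=x'(y').\overline{x}[y].(T^A_{y,y'}\mid T^B_{x,x'})$; $T^{!A}_{x,x'}=\overline{x'}[w'].(!w'(w).?x[y].w(y').(T^A_{y,y'}\mid w[])\mid x'().0)$; $T^{?A}_{x,x'}=!x(y).?x'[m].\overline{m}[z].(z(y').(T^A_{y,y'}\mid z[])\mid m().0)$; $T^{A_1\&A_2}_{x,x'}=x'.\mathrm{case}(x.1;T^{A_1}_{x,x'},x.2;T^{A_2}_{x,x'})$;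 $T^{A_1\oplus A_2}_{x,x'}=x.\mathrm{case}(P_1,P_2)$, $P_i=\overline{x'}[w].(w.i;w(y').(T^{A_i}_{x,y'}\mid w[])\mid x'().0)$. Transformer context with closing name ($z$ fresh): $\mathcal{T}_\Delta[-]=(\nu x_n)(\cdots(\nu x_1)([-]\mid T^{A_1}_{x_1,y_1})\cdots\mid T^{A_n}_{x_n,y_n})\mid z[]$, a typed context $\Delta\Rightarrow\Delta^{L\bot},z:\mathbf{1}$. -}

module Defs where

open import Data.Unit using (⊤; tt)
open import Data.Empty using (⊥)
open import Data.Product using (Σ; Σ-syntax; _×_; _,_; proj₁; proj₂)
open import Data.Sum using (_⊎_; inj₁; inj₂)
open import Data.List using (List; []; _∷_; _++_; map; concat)
open import Data.List.Relation.Unary.All using (All)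
open import Data.List.Relation.Binary.Permutation.Homogeneous using (Permutation)
open import Data.List.Relation.Binary.Permutation.Propositional using (_↭_; refl; prep; swap; trans)
open import Relation.Binary.PropositionalEquality using (_≡_)
open import Function.Bundles using (_⇔_)

infixr 7 _⊗_ _⅋_
infixr 6 _⊕_ _&_

data Ty : Set where
  `1 `⊥         : Ty
  _⊗_ _⅋_ _⊕_ _&_ : Ty → Ty → Ty
  `!_ `?_       : Ty → Ty

dual : Ty → Ty
dual `1      = `⊥
dual `⊥      = `1
dual (A ⊗ B) = dual A ⅋ dual B
dual (A ⅋ B) = dual A ⊗ dual B
dual (A ⊕ B) = dual A & dual B
dual (A & B) = dual A ⊕ dual B
dual (`! A)  = `? dual A
dual (`? A)  = `! dual A

-- Typing contexts x₁:A₁,…,xₙ:Aₙ, channel names represented positionally.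
Ctx : Set
Ctx = List Ty

-- Finite multisets over ⟦A⟧ are represented by
-- lists, identified up to the equivalence Eq (permutation, recursively
-- up to Eq of the elements); "sets" of elements of ⟦A⟧ / ⟦Γ⟧ are
-- predicates, and the semantics below is closed under Eq.

⟦_⟧ : Ty → Set
⟦ `1 ⟧    = ⊤
⟦ `⊥ ⟧    = ⊤
⟦ A ⊗ B ⟧ = ⟦ A ⟧ × ⟦ B ⟧
⟦ A ⅋ B ⟧ = ⟦ A ⟧ × ⟦ B ⟧
⟦ A ⊕ B ⟧ = ⟦ A ⟧ ⊎ ⟦ B ⟧
⟦ A & B ⟧ = ⟦ A ⟧ ⊎ ⟦ B ⟧
⟦ `! A ⟧  = List ⟦ A ⟧
⟦ `? A ⟧  = List ⟦ A ⟧

Eq : (A : Ty) → ⟦ A ⟧ → ⟦ A ⟧ → Set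
Eq `1 _ _ = ⊤
Eq `⊥ _ _ = ⊤
Eq (A ⊗ B) (a , b) (a' , b') = Eq A a a' × Eq B b b'
Eq (A ⅋ B) (a , b) (a' , b') = Eq A a a' × Eq B b b'
Eq (A ⊕ B) (inj₁ a) (inj₁ a') = Eq A a a'
Eq (A ⊕ B) (inj₂ b) (inj₂ b') = Eq B b b'
Eq (A ⊕ B) _ _ = ⊥
Eq (A & B) (inj₁ a) (inj₁ a') = Eq A a a'
Eq (A & B) (inj₂ b) (inj₂ b') = Eq B b b'
Eq (A & B) _ _ = ⊥
Eq (`! A) m m' = Permutation (Eq A) m m'
Eq (`? A) m m' = Permutation (Eq A) m m'

-- the identification ⟦A⟧ = ⟦A^⊥⟧
flip : (A : Ty) → ⟦ A ⟧ → ⟦ dual A ⟧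
flip `1 _ = tt
flip `⊥ _ = tt
flip (A ⊗ B) (a , b) = flip A a , flip B b
flip (A ⅋ B) (a , b) = flip A a , flip B b
flip (A ⊕ B) (inj₁ a) = inj₁ (flip A a)
flip (A ⊕ B) (inj₂ b) = inj₂ (flip B b)
flip (A & B) (inj₁ a) = inj₁ (flip A a)
flip (A & B) (inj₂ b) = inj₂ (flip B b)
flip (`! A) m = map (flip A) m
flip (`? A) m = map (flip A) m

Env : Ctx → Set
Env []      = ⊤
Env (A ∷ Γ) = ⟦ A ⟧ × Env Γ

EnvEq : (Γ : Ctx) → Env Γ → Env Γ → Set
EnvEq [] _ _ = ⊤
EnvEq (A ∷ Γ) (a , γ) (a' , γ') = Eq A a a' × EnvEq Γ γ γ'

split : (Γ : Ctx) {Δ : Ctx} → Env (Γ ++ Δ) → Env Γ × Env Δ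
split [] ρ = tt , ρ
split (A ∷ Γ) (a , ρ) with split Γ ρ
... | γ , δ = (a , γ) , δ

permEnv : {Γ Δ : Ctx} → Γ ↭ Δ → Env Γ → Env Δ
permEnv refl γ = γ
permEnv (prep _ p) (a , γ) = a , permEnv p γ
permEnv (swap _ _ p) (a , b , γ) = b , a , permEnv p γ
permEnv (trans p q) γ = permEnv q (permEnv p γ)

bigU : (Γ : Ctx) → List (Env (map `?_ Γ)) → Env (map `?_ Γ)
bigU [] _ = tt
bigU (A ∷ Γ) es = concat (map proj₁ es) , bigU Γ (map proj₂ es)

-- Typed processes of CP + Mix₀ + Mix₂ (intrinsically typed; the channel
-- acted upon is the head of the context; exchange is explicit).

data Proc : Ctx → Set where
  fwd      : ∀ {A} → Proc (A ∷ dual A ∷ [])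
  close    : Proc (`1 ∷ [])
  wait     : ∀ {Γ} → Proc Γ → Proc (`⊥ ∷ Γ)
  out      : ∀ {Γ Δ A B} → Proc (A ∷ Γ) → Proc (B ∷ Δ) → Proc (A ⊗ B ∷ Γ ++ Δ)
  inp      : ∀ {Γ A B} → Proc (A ∷ B ∷ Γ) → Proc (A ⅋ B ∷ Γ)
  inl      : ∀ {Γ A B} → Proc (A ∷ Γ) → Proc (A ⊕ B ∷ Γ)
  inr      : ∀ {Γ A B} → Proc (B ∷ Γ) → Proc (A ⊕ B ∷ Γ)
  case     : ∀ {Γ A B} → Proc (A ∷ Γ) → Proc (B ∷ Γ) → Proc (A & B ∷ Γ)
  server   : ∀ {A} (Γ : Ctx) → Proc (A ∷ map `?_ Γ) → Proc (`! A ∷ map `?_ Γ)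
  client   : ∀ {Γ A} → Proc (A ∷ Γ) → Proc (`? A ∷ Γ)
  weaken   : ∀ {Γ A} → Proc Γ → Proc (`? A ∷ Γ)
  contract : ∀ {Γ A} → Proc (`? A ∷ `? A ∷ Γ) → Proc (`? A ∷ Γ)
  cut      : ∀ {Γ Δ A} → Proc (A ∷ Γ) → Proc (dual A ∷ Δ) → Proc (Γ ++ Δ)
  nil      : Proc []
  mix      : ∀ {Γ Δ} → Proc Γ → Proc Δ → Proc (Γ ++ Δ)
  exch     : ∀ {Γ Δ} → Γ ↭ Δ → Proc Γ → Proc Δ

⟦_⟧P : ∀ {Γ} → Proc Γ → Env Γ → Set
⟦ fwd {A} ⟧P (a , b , _) = Eq (dual A) (flip A a) b
⟦ close ⟧P _ = ⊤
⟦ wait P ⟧P (_ , γ) = ⟦ P ⟧P γ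
⟦ out {Γ} P Q ⟧P ((a , b) , ρ) with split Γ ρ
... | γ , δ = ⟦ P ⟧P (a , γ) × ⟦ Q ⟧P (b , δ)
⟦ inp P ⟧P ((a , b) , γ) = ⟦ P ⟧P (a , b , γ)
⟦ inl P ⟧P (inj₁ a , γ) = ⟦ P ⟧P (a , γ)
⟦ inl P ⟧P (inj₂ _ , _) = ⊥
⟦ inr P ⟧P (inj₁ _ , _) = ⊥
⟦ inr P ⟧P (inj₂ b , γ) = ⟦ P ⟧P (b , γ)
⟦ case P Q ⟧P (inj₁ a , γ) = ⟦ P ⟧P (a , γ)
⟦ case P Q ⟧P (inj₂ b , γ) = ⟦ Q ⟧P (b , γ)
⟦ server {A} Γ P ⟧P (m , ρ) =
  Σ[ ps ∈ List (⟦ A ⟧ × Env (map `?_ Γ)) ]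
    (All (λ p → ⟦ P ⟧P p) ps
     × Eq (`! A) (map proj₁ ps) m
     × EnvEq (map `?_ Γ) (bigU Γ (map proj₂ ps)) ρ)
⟦ client {A = A} P ⟧P (m , γ) = Σ[ a ∈ ⟦ A ⟧ ] (Eq (`? A) (a ∷ []) m × ⟦ P ⟧P (a , γ))
⟦ weaken {A = A} P ⟧P (m , γ) = Eq (`? A) [] m × ⟦ P ⟧P γ
⟦ contract {A = A} P ⟧P (m , γ) =
  Σ[ m₁ ∈ List ⟦ A ⟧ ] Σ[ m₂ ∈ List ⟦ A ⟧ ] (Eq (`? A) (m₁ ++ m₂) m × ⟦ P ⟧P (m₁ , m₂ , γ))
⟦ cut {Γ} {A = A} P Q ⟧P ρ with split Γ ρ
... | γ , δ = Σ[ a ∈ ⟦ A ⟧ ] (⟦ P ⟧P (a , γ) × ⟦ Q ⟧P (flip A a , δ))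
⟦ nil ⟧P _ = ⊤
⟦ mix {Γ} P Q ⟧P ρ with split Γ ρ
... | γ , δ = ⟦ P ⟧P γ × ⟦ Q ⟧P δ
⟦ exch π P ⟧P ρ = Σ[ w ∈ _ ] (⟦ P ⟧P w × permEnv π w ≡ ρ)

-- Typed contexts K ⊢ Σ ⇒ Γ.
-- Repl A Δ Φ Ψ : Ψ is Φ with (one occurrence of) the channel x:A
-- replaced by the channels Δ, i.e. Φ = Γ,x:A and Ψ = Γ,Δ.

data Repl (A : Ty) (Δ : Ctx) : Ctx → Ctx → Set where
  here  : ∀ {Γ} → Repl A Δ (A ∷ Γ) (Δ ++ Γ)
  there : ∀ {B Φ Ψ} → Repl A Δ Φ Ψ → Repl A Δ (B ∷ Φ) (B ∷ Ψ)

unplug : ∀ {A Δ Φ Ψ} → Repl A Δ Φ Ψ → Env Ψ → Env Δ × (⟦ A ⟧ → Env Φ)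
unplug {Δ = Δ} here ρ with split Δ ρ
... | δ , γ = δ , (λ a → a , γ)
unplug (there r) (b , ρ) with unplug r ρ
... | δ , f = δ , (λ a → b , f a)

data Ctxt (Σ₀ : Ctx) : Ctx → Set where
  hole : Ctxt Σ₀ Σ₀
  cutK : ∀ {A Δ Φ Ψ} → Ctxt Σ₀ Φ → Repl A Δ Φ Ψ → Proc (dual A ∷ Δ) → Ctxt Σ₀ Ψ
  mixK : ∀ {Γ Δ} → Ctxt Σ₀ Γ → Proc Δ → Ctxt Σ₀ (Γ ++ Δ)

⟦_⟧K : ∀ {Σ₀ Γ} → Ctxt Σ₀ Γ → (Env Σ₀ → Set) → Env Γ → Set
⟦ hole ⟧K X σ = X σ
⟦ cutK {A = A} K r Q ⟧K X ρ with unplug r ρ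
... | δ , f = Σ[ a ∈ ⟦ A ⟧ ] (⟦ K ⟧K X (f a) × ⟦ Q ⟧P (flip A a , δ))
⟦ mixK {Γ} K Q ⟧K X ρ with split Γ ρ
... | γ , δ = ⟦ K ⟧K X γ × ⟦ Q ⟧P δ

_∘K_ : ∀ {Σ₀ Φ Γ} → Ctxt Φ Γ → Ctxt Σ₀ Φ → Ctxt Σ₀ Γ
hole ∘K K' = K'
cutK K r Q ∘K K' = cutK (K ∘K K') r Q
mixK K Q ∘K K' = mixK (K ∘K K') Q

liftK : ∀ {B Φ Γ} → Ctxt Φ Γ → Ctxt (B ∷ Φ) (B ∷ Γ)
liftK hole = hole
liftK (cutK K r Q) = cutK (liftK K) (there r) Q
liftK (mixK K Q) = mixK (liftK K) Q

L : Ty → Ty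
L `⊥      = `⊥
L `1      = `1 ⊗ `⊥
L (A ⊗ B) = ((L A ⅋ `1) ⊗ (L B ⅋ `1)) ⊗ `⊥
L (A ⅋ B) = L A ⅋ L B
L (A ⊕ B) = ((L A ⅋ `1) ⊕ (L B ⅋ `1)) ⊗ `⊥
L (A & B) = L A & L B
L (`! A)  = `! (L A ⅋ `1) ⊗ `⊥
L (`? A)  = `? ((L A ⅋ `1) ⊗ `⊥)

F : (A : Ty) → ⟦ A ⟧ → ⟦ L A ⟧
F `⊥ _ = tt
F `1 _ = tt , tt
F (A ⅋ B) (a , b) = F A a , F B b
F (A ⊗ B) (a , b) = ((F A a , tt) , (F B b , tt)) , tt
F (A & B) (inj₁ a) = inj₁ (F A a)
F (A & B) (inj₂ b) = inj₂ (F B b)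
F (A ⊕ B) (inj₁ a) = inj₁ (F A a , tt) , tt
F (A ⊕ B) (inj₂ b) = inj₂ (F B b , tt) , tt
F (`! A) m = map (λ a → F A a , tt) m , tt
F (`? A) m = map (λ a → (F A a , tt) , tt) m

FΔ : (Δ : Ctx) → Env Δ → Env (map L Δ ++ `1 ∷ [])
FΔ [] _ = tt , tt
FΔ (A ∷ Δ) (a , γ) = F A a , FΔ Δ γ

pad : ∀ {A} → Proc (dual A ∷ L A ∷ []) → Proc ((L A ⅋ `1) ∷ dual A ∷ [])
pad {A} T = inp (exch (trans (swap _ _ refl) (prep _ (swap _ _ refl))) (mix T close))

Tr : (A : Ty) → Proc (dual A ∷ L A ∷ [])
Tr `⊥ = fwd
Tr `1 = exch (swap _ _ refl) (out fwd (wait nil))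
Tr (A ⊗ B) =
  inp (exch (trans (swap _ _ refl) (prep _ (swap _ _ refl)))
        (out (out (pad (Tr A)) (pad (Tr B))) (wait nil)))
Tr (A ⅋ B) =
  exch (swap _ _ refl)
    (inp (exch (trans (swap _ _ refl) (prep _ (swap _ _ refl)))
           (out (Tr A) (Tr B))))
Tr (`! A) =
  exch (swap _ _ refl)
    (out (server (dual A ∷ [])
           (exch (swap _ _ refl)
             (client (exch (swap _ _ refl) (pad (Tr A))))))
         (wait nil))
Tr (`? A) =
  server (((L A ⅋ `1) ⊗ `⊥) ∷ [])
    (exch (swap _ _ refl) (client (out (pad (Tr A)) (wait nil))))
Tr (A & B) =
  exch (swap _ _ refl)
    (case (exch (swap _ _ refl) (inl (Tr A)))
          (exch (swap _ _ refl) (inr (Tr B))))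
Tr (A ⊕ B) =
  case (exch (swap _ _ refl) (out (inl (pad (Tr A))) (wait nil)))
       (exch (swap _ _ refl) (out (inr (pad (Tr B))) (wait nil)))

cuts : (Δ : Ctx) → Ctxt Δ (map L Δ)
cuts [] = hole
cuts (A ∷ Δ) = liftK (cuts Δ) ∘K cutK hole here (Tr A)

𝒯 : (Δ : Ctx) → Ctxt Δ (map L Δ ++ `1 ∷ [])
𝒯 Δ = mixK (cuts Δ) close

_≐_ : ∀ {Γ} → (Env Γ → Set) → (Env Γ → Set) → Set
S ≐ T = ∀ v → S v ⇔ T v

Closed : (Γ : Ctx) → (Env Γ → Set) → Set
Closed Γ X = ∀ {u v} → EnvEq Γ u v → X u → X v

FΔImg : (Δ : Ctx) → (Env Δ → Set) → Env (map L Δ ++ `1 ∷ []) → Set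
FΔImg Δ X v = Σ[ u ∈ Env Δ ] (X u × EnvEq (map L Δ ++ `1 ∷ []) (FΔ Δ u) v)

{-# OPTIONS --safe #-}
-- Under the identification ⟦A⟧ = ⟦A^⊥⟧, each transformer T^A denotes exactly the graph of F_A up
-- to Eq: it relates b to y iff y ~ F_A(b).  This is an induction on A in which exchanges, the
-- padding with 1 and the closing ⊥ are bookkeeping.  The real work is at the exponentials: there
-- every replica of the server talks to exactly one client, and such a server relates two multisets
-- iff they are permutations of pointwise related lists; for the graph of F_A this says that one
-- multiset is the image of the other under F_A.  Cutting X against T^{A₁}, …, T^{Aₙ} in turn thus
-- applies F componentwise, and the closing z[] contributes the final *.
module Submission where

open import Defs
open import Level using (0ℓ)
open import Data.Unit using (⊤; tt)
open import Data.Product using (Σ-syntax; _×_; _,_; proj₁; proj₂)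
open import Data.Sum using (inj₁; inj₂)
open import Data.List using (List; []; _∷_; _++_; map; concat)
open import Data.List.Properties using (map-∘; map-cong; map-id)
open import Data.List.Relation.Unary.All as All using (All; []; _∷_)
open import Data.List.Relation.Binary.Pointwise as Pointwise using (Pointwise; []; _∷_)
open import Data.List.Relation.Binary.Permutation.Homogeneous as Perm using (Permutation)
open import Data.List.Relation.Binary.Permutation.Propositional using (refl; prep; swap; trans)
import Data.List.Relation.Binary.Permutation.Setoid.Properties as PermProps
open import Relation.Binary.Bundles using (Setoid)
open import Relation.Binary.Definitions using (Reflexive; Symmetric; Transitive)
open import Relation.Binary.PropositionalEquality as ≡ using (_≡_; cong; cong₂; subst)
open import Function.Bundles using (_⇔_; mk⇔; Equivalence)
open Equivalence using (to; from)
open import Function.Construct.Composition using (_⇔-∘_)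
open import Function.Construct.Identity using (⇔-id)
open import Data.Product.Function.NonDependent.Propositional using (_×-⇔_)
import Data.Product.Function.Dependent.Propositional as Σ
open import Function.Related.Propositional using (equivalence; module EquationalReasoning)

Eq-refl : (A : Ty) → Reflexive (Eq A)
Eq-refl `1      = tt
Eq-refl `⊥      = tt
Eq-refl (A ⊗ B) = Eq-refl A , Eq-refl B
Eq-refl (A ⅋ B) = Eq-refl A , Eq-refl B
Eq-refl (A ⊕ B) {inj₁ _} = Eq-refl A
Eq-refl (A ⊕ B) {inj₂ _} = Eq-refl B
Eq-refl (A & B) {inj₁ _} = Eq-refl A
Eq-refl (A & B) {inj₂ _} = Eq-refl B
Eq-refl (`! A)  = Perm.refl (Pointwise.refl (Eq-refl A))
Eq-refl (`? A)  = Perm.refl (Pointwise.refl (Eq-refl A))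

Eq-sym : (A : Ty) → Symmetric (Eq A)
Eq-sym `1      _ = tt
Eq-sym `⊥      _ = tt
Eq-sym (A ⊗ B) (p , q) = Eq-sym A p , Eq-sym B q
Eq-sym (A ⅋ B) (p , q) = Eq-sym A p , Eq-sym B q
Eq-sym (A ⊕ B) {inj₁ _} {inj₁ _} p = Eq-sym A p
Eq-sym (A ⊕ B) {inj₂ _} {inj₂ _} p = Eq-sym B p
Eq-sym (A & B) {inj₁ _} {inj₁ _} p = Eq-sym A p
Eq-sym (A & B) {inj₂ _} {inj₂ _} p = Eq-sym B p
Eq-sym (`! A)  p = Perm.sym (Eq-sym A) p
Eq-sym (`? A)  p = Perm.sym (Eq-sym A) p

Eq-trans : (A : Ty) → Transitive (Eq A)
Eq-trans `1      _ _ = tt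
Eq-trans `⊥      _ _ = tt
Eq-trans (A ⊗ B) (p , q) (p' , q') = Eq-trans A p p' , Eq-trans B q q'
Eq-trans (A ⅋ B) (p , q) (p' , q') = Eq-trans A p p' , Eq-trans B q q'
Eq-trans (A ⊕ B) {inj₁ _} {inj₁ _} {inj₁ _} p q = Eq-trans A p q
Eq-trans (A ⊕ B) {inj₂ _} {inj₂ _} {inj₂ _} p q = Eq-trans B p q
Eq-trans (A & B) {inj₁ _} {inj₁ _} {inj₁ _} p q = Eq-trans A p q
Eq-trans (A & B) {inj₂ _} {inj₂ _} {inj₂ _} p q = Eq-trans B p q
Eq-trans (`! A)  p q = Perm.trans p q
Eq-trans (`? A)  p q = Perm.trans p q

Eq-setoid : Ty → Setoid 0ℓ 0ℓ
Eq-setoid A = record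
  { Carrier       = ⟦ A ⟧
  ; _≈_           = Eq A
  ; isEquivalence = record { refl = Eq-refl A ; sym = Eq-sym A ; trans = Eq-trans A }
  }

-- F A ∘ (flip A)⁻¹, defined by its own recursion so that it unfolds in step with Tr A.
Fdual : (A : Ty) → ⟦ dual A ⟧ → ⟦ L A ⟧
Fdual `1      _ = tt , tt
Fdual `⊥      _ = tt
Fdual (A ⊗ B) (a , b) = ((Fdual A a , tt) , (Fdual B b , tt)) , tt
Fdual (A ⅋ B) (a , b) = Fdual A a , Fdual B b
Fdual (A ⊕ B) (inj₁ a) = inj₁ (Fdual A a , tt) , tt
Fdual (A ⊕ B) (inj₂ b) = inj₂ (Fdual B b , tt) , tt
Fdual (A & B) (inj₁ a) = inj₁ (Fdual A a)
Fdual (A & B) (inj₂ b) = inj₂ (Fdual B b)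
Fdual (`! A)  m = map (λ b → Fdual A b , tt) m , tt
Fdual (`? A)  m = map (λ b → (Fdual A b , tt) , tt) m

Fdual-resp : (A : Ty) {b b' : ⟦ dual A ⟧} → Eq (dual A) b b' → Eq (L A) (Fdual A b) (Fdual A b')
Fdual-resp `1      _ = tt , tt
Fdual-resp `⊥      _ = tt
Fdual-resp (A ⊗ B) (p , q) = ((Fdual-resp A p , tt) , (Fdual-resp B q , tt)) , tt
Fdual-resp (A ⅋ B) (p , q) = Fdual-resp A p , Fdual-resp B q
Fdual-resp (A ⊕ B) {inj₁ _} {inj₁ _} p = (Fdual-resp A p , tt) , tt
Fdual-resp (A ⊕ B) {inj₂ _} {inj₂ _} p = (Fdual-resp B p , tt) , tt
Fdual-resp (A & B) {inj₁ _} {inj₁ _} p = Fdual-resp A p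
Fdual-resp (A & B) {inj₂ _} {inj₂ _} p = Fdual-resp B p
Fdual-resp (`! A)  p =
  PermProps.map⁺ (Eq-setoid (dual A)) (Eq-setoid (L A ⅋ `1)) (λ q → Fdual-resp A q , tt) p , tt
Fdual-resp (`? A)  p =
  PermProps.map⁺ (Eq-setoid (dual A)) (Eq-setoid ((L A ⅋ `1) ⊗ `⊥)) (λ q → (Fdual-resp A q , tt) , tt) p

Fdual-flip : (A : Ty) (a : ⟦ A ⟧) → Fdual A (flip A a) ≡ F A a
Fdual-flip `1      _ = ≡.refl
Fdual-flip `⊥      _ = ≡.refl
Fdual-flip (A ⊗ B) (a , b) = cong₂ (λ x y → ((x , tt) , (y , tt)) , tt) (Fdual-flip A a) (Fdual-flip B b)
Fdual-flip (A ⅋ B) (a , b) = cong₂ _,_ (Fdual-flip A a) (Fdual-flip B b)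
Fdual-flip (A ⊕ B) (inj₁ a) = cong (λ x → inj₁ (x , tt) , tt) (Fdual-flip A a)
Fdual-flip (A ⊕ B) (inj₂ b) = cong (λ x → inj₂ (x , tt) , tt) (Fdual-flip B b)
Fdual-flip (A & B) (inj₁ a) = cong inj₁ (Fdual-flip A a)
Fdual-flip (A & B) (inj₂ b) = cong inj₂ (Fdual-flip B b)
Fdual-flip (`! A)  m =
  cong (_, tt) (≡.trans (≡.sym (map-∘ m)) (map-cong (λ a → cong (_, tt) (Fdual-flip A a)) m))
Fdual-flip (`? A)  m =
  ≡.trans (≡.sym (map-∘ m)) (map-cong (λ a → cong (λ x → (x , tt) , tt) (Fdual-flip A a)) m)

-- The left-hand sides are what ⟦ exch π Q ⟧P unfolds to for a swap and a rotation π; stating them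
-- for an arbitrary predicate S (rather than ⟦ Q ⟧P) lets S be found by unification.
swap-sem : ∀ {X Y Γ : Set} {S : X × Y × Γ → Set} {a b γ} →
           (Σ[ w ∈ X × Y × Γ ] (S w × (proj₁ (proj₂ w) , proj₁ w , proj₂ (proj₂ w)) ≡ (b , a , γ)))
           ⇔ S (a , b , γ)
swap-sem = mk⇔ (λ { (_ , s , ≡.refl) → s }) (λ s → _ , s , ≡.refl)

rotate-sem : ∀ {X Y Z Γ : Set} {S : X × Y × Z × Γ → Set} {x y z γ} →
             (Σ[ w ∈ X × Y × Z × Γ ]
                (S w × (proj₁ (proj₂ w) , proj₁ (proj₂ (proj₂ w)) , proj₁ w , proj₂ (proj₂ (proj₂ w)))
                       ≡ (y , z , x , γ)))
             ⇔ S (x , y , z , γ)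
rotate-sem = mk⇔ (λ { (_ , s , ≡.refl) → s }) (λ s → _ , s , ≡.refl)

pad-sem : ∀ {A} (T : Proc (dual A ∷ L A ∷ [])) {l u b} →
          ⟦ pad T ⟧P ((l , u) , b , tt) ⇔ (⟦ T ⟧P (b , l , tt) × ⊤)
pad-sem T = rotate-sem

client-sem : ∀ {A Γ} (P : Proc (A ∷ Γ)) {Q : ⟦ A ⟧ → Set} {cs γ} →
             (∀ {c} → ⟦ P ⟧P (c , γ) ⇔ Q c) →
             ⟦ client P ⟧P (cs , γ) ⇔ (Σ[ c ∈ ⟦ A ⟧ ] (Permutation (Eq A) (c ∷ []) cs × Q c))
client-sem P P-sem =
  mk⇔ (λ (c , c∼cs , p) → c , c∼cs , to P-sem p) (λ (c , c∼cs , q) → c , c∼cs , from P-sem q)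

Permutation-empty-inv : ∀ {X : Set} {R : X → X → Set} {ys} → Permutation R [] ys → ys ≡ []
Permutation-empty-inv (Perm.refl []) = ≡.refl
Permutation-empty-inv (Perm.trans p q) with ≡.refl ← Permutation-empty-inv p = Permutation-empty-inv q

Permutation-singleton-inv : ∀ {X : Set} {R : X → X → Set} → Transitive R →
                            ∀ {x ys} → Permutation R (x ∷ []) ys → Σ[ y ∈ X ] (ys ≡ y ∷ [] × R x y)
Permutation-singleton-inv R-trans (Perm.refl (r ∷ [])) = _ , ≡.refl , r
Permutation-singleton-inv R-trans (Perm.prep r p) with ≡.refl ← Permutation-empty-inv p = _ , ≡.refl , r
Permutation-singleton-inv R-trans (Perm.trans p q)
  with _ , ≡.refl , r ← Permutation-singleton-inv R-trans p
  with _ , ≡.refl , r' ← Permutation-singleton-inv R-trans q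
  = _ , ≡.refl , R-trans r r'

shares : {S X : Set} → List (S × (List X × ⊤)) → List X
shares ps = concat (map proj₁ (map proj₂ ps))

-- A replica of a server with one ?-channel, of type C, is its value s together with its share cs
-- of that channel (the trailing ⊤ is the empty rest of the context); bigU concatenates the shares.
SingletonShare : {S : Set} (C : Ty) → (S → ⟦ C ⟧ → Set) → S × (List ⟦ C ⟧ × ⊤) → Set
SingletonShare C R (s , cs , _) = Σ[ c ∈ ⟦ C ⟧ ] (Permutation (Eq C) (c ∷ []) cs × R s c)

module _ {S : Set} {C : Ty} {R : S → ⟦ C ⟧ → Set} where

  singleton-shares⇒Pointwise : (∀ {s c c'} → R s c → Eq C c c' → R s c') →
                               ∀ {ps} → All (SingletonShare C R) ps → Pointwise R (map proj₁ ps) (shares ps)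
  singleton-shares⇒Pointwise R-resp [] = []
  singleton-shares⇒Pointwise R-resp {(_ , cs , _) ∷ _} ((c , c∼cs , r) ∷ rest)
    with _ , ≡.refl , c≈c' ← Permutation-singleton-inv (Eq-trans C) c∼cs
    = R-resp r c≈c' ∷ singleton-shares⇒Pointwise R-resp rest

  Pointwise⇒singleton-shares : ∀ {xs ys} → Pointwise R xs ys →
    Σ[ ps ∈ List (S × (List ⟦ C ⟧ × ⊤)) ]
      (All (SingletonShare C R) ps × map proj₁ ps ≡ xs × shares ps ≡ ys)
  Pointwise⇒singleton-shares [] = [] , [] , ≡.refl , ≡.refl
  Pointwise⇒singleton-shares {x ∷ _} {y ∷ _} (r ∷ rs)
    with ps , all , ≡.refl , ≡.refl ← Pointwise⇒singleton-shares rs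
    = (x , y ∷ [] , tt) ∷ ps , (y , Eq-refl (`? C) , r) ∷ all , ≡.refl , ≡.refl

Lift : {S C : Ty} → (⟦ S ⟧ → ⟦ C ⟧ → Set) → List ⟦ S ⟧ → List ⟦ C ⟧ → Set
Lift {S} {C} R n k =
  Σ[ xs ∈ List ⟦ S ⟧ ] Σ[ ys ∈ List ⟦ C ⟧ ]
    (Pointwise R xs ys × Permutation (Eq S) xs n × Permutation (Eq C) ys k)

server-sem : ∀ {S C} (P : Proc (S ∷ `? C ∷ [])) {R : ⟦ S ⟧ → ⟦ C ⟧ → Set} →
             (∀ {s c c'} → R s c → Eq C c c' → R s c') →
             (∀ {s cs} → ⟦ P ⟧P (s , cs , tt) ⇔ SingletonShare C R (s , cs , tt)) →
             ∀ {n k} → ⟦ server (C ∷ []) P ⟧P (n , k , tt) ⇔ Lift R n k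
server-sem P {R} R-resp P-sem {n} {k} = mk⇔ sound complete
  where
  sound : ⟦ server _ P ⟧P (n , k , tt) → Lift R n k
  sound (ps , Ps , ps∼n , shares∼k , _) =
    map proj₁ ps , shares ps , singleton-shares⇒Pointwise R-resp (All.map (to P-sem) Ps) , ps∼n , shares∼k

  complete : Lift R n k → ⟦ server _ P ⟧P (n , k , tt)
  complete (_ , _ , rs , xs∼n , ys∼k)
    with ps , all , ≡.refl , ≡.refl ← Pointwise⇒singleton-shares rs
    = ps , All.map (from P-sem) all , xs∼n , ys∼k , tt

Lift-transpose : ∀ {S C} {R : ⟦ S ⟧ → ⟦ C ⟧ → Set} {n k} → Lift R n k ⇔ Lift (λ c s → R s c) k n
Lift-transpose = mk⇔ transpose transpose
  where
  transpose : ∀ {S C} {R : ⟦ S ⟧ → ⟦ C ⟧ → Set} {n k} → Lift R n k → Lift (λ c s → R s c) k n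
  transpose (xs , ys , rs , xs∼n , ys∼k) = ys , xs , Pointwise.symmetric (λ r → r) rs , ys∼k , xs∼n

Lift-graph : ∀ {S C} (h : ⟦ S ⟧ → ⟦ C ⟧) → (∀ {s s'} → Eq S s s' → Eq C (h s) (h s')) →
             ∀ {m n} → Lift (λ s c → Eq C (h s) c) m n ⇔ Permutation (Eq C) (map h m) n
Lift-graph {S} {C} h h-resp {m} {n} = mk⇔ sound complete
  where
  Graph : ⟦ S ⟧ → ⟦ C ⟧ → Set
  Graph s c = Eq C (h s) c

  sound : Lift Graph m n → Permutation (Eq C) (map h m) n
  sound (xs , ys , rs , xs∼m , ys∼n) = Perm.trans hm∼hxs (Perm.trans (Perm.refl hxs≋ys) ys∼n)
    where
    hm∼hxs : Permutation (Eq C) (map h m) (map h xs)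
    hm∼hxs = PermProps.map⁺ (Eq-setoid S) (Eq-setoid C) h-resp (Perm.sym (Eq-sym S) xs∼m)
    hxs≋ys : Pointwise (Eq C) (map h xs) ys
    hxs≋ys = subst (Pointwise (Eq C) (map h xs)) (map-id ys) (Pointwise.map⁺ h (λ c → c) rs)

  complete : Permutation (Eq C) (map h m) n → Lift Graph m n
  complete hm∼n = m , map h m , graph , Eq-refl (`! S) , hm∼n
    where
    graph : Pointwise Graph m (map h m)
    graph = subst (λ xs → Pointwise Graph xs (map h m)) (map-id m)
                  (Pointwise.map⁺ (λ s → s) h (Pointwise.refl (Eq-refl C)))

Tr-sem : (A : Ty) {b : ⟦ dual A ⟧} {y : ⟦ L A ⟧} → ⟦ Tr A ⟧P (b , y , tt) ⇔ Eq (L A) (Fdual A b) y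

padTr-sem : (A : Ty) {b : ⟦ dual A ⟧} {l : ⟦ L A ⟧} {u : ⊤} →
            ⟦ pad (Tr A) ⟧P ((l , u) , b , tt) ⇔ Eq (L A ⅋ `1) (Fdual A b , tt) (l , u)
padTr-sem A = (Tr-sem A ×-⇔ ⇔-id ⊤) ⇔-∘ pad-sem (Tr A)

Tr-sem `1 = mk⇔ (λ _ → tt , tt) (λ _ → from swap-sem (tt , tt))
Tr-sem `⊥ = ⇔-id ⊤
Tr-sem (A ⊗ B) = ((padTr-sem A ×-⇔ padTr-sem B) ×-⇔ ⇔-id ⊤) ⇔-∘ rotate-sem
Tr-sem (A ⅋ B) = (Tr-sem A ×-⇔ Tr-sem B) ⇔-∘ (rotate-sem ⇔-∘ swap-sem)
Tr-sem (A & B) {inj₁ _} {inj₁ _} = Tr-sem A ⇔-∘ (swap-sem ⇔-∘ swap-sem)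
Tr-sem (A & B) {inj₂ _} {inj₂ _} = Tr-sem B ⇔-∘ (swap-sem ⇔-∘ swap-sem)
Tr-sem (A & B) {inj₁ _} {inj₂ _} = swap-sem ⇔-∘ swap-sem
Tr-sem (A & B) {inj₂ _} {inj₁ _} = swap-sem ⇔-∘ swap-sem
Tr-sem (A ⊕ B) {inj₁ _} {inj₁ _ , _} = (padTr-sem A ×-⇔ ⇔-id ⊤) ⇔-∘ swap-sem
Tr-sem (A ⊕ B) {inj₂ _} {inj₂ _ , _} = (padTr-sem B ×-⇔ ⇔-id ⊤) ⇔-∘ swap-sem
Tr-sem (A ⊕ B) {inj₁ _} {inj₂ _ , _} = swap-sem
Tr-sem (A ⊕ B) {inj₂ _} {inj₁ _ , _} = swap-sem
Tr-sem (`! A) = (server⇔map ×-⇔ ⇔-id ⊤) ⇔-∘ swap-sem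
  where
  g : ⟦ dual A ⟧ → ⟦ L A ⅋ `1 ⟧
  g b = Fdual A b , tt
  g-resp : ∀ {b b'} → Eq (dual A) b b' → Eq (L A ⅋ `1) (g b) (g b')
  g-resp b≈b' = Fdual-resp A b≈b' , tt
  R-resp : ∀ {s b b'} → Eq (L A ⅋ `1) (g b) s → Eq (dual A) b b' → Eq (L A ⅋ `1) (g b') s
  R-resp gb≈s b≈b' = Eq-trans (L A ⅋ `1) (Eq-sym (L A ⅋ `1) (g-resp b≈b')) gb≈s
  copy : Proc (L A ⅋ `1 ∷ `? dual A ∷ [])
  copy = exch (swap _ _ refl) (client (exch (swap _ _ refl) (pad (Tr A))))
  copy-sem : ∀ {s bs} →
             ⟦ copy ⟧P (s , bs , tt) ⇔ SingletonShare (dual A) (λ s b → Eq (L A ⅋ `1) (g b) s) (s , bs , tt)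
  copy-sem = client-sem (exch (swap _ _ refl) (pad (Tr A))) (padTr-sem A ⇔-∘ swap-sem) ⇔-∘ swap-sem
  server⇔map : ∀ {n bs} →
               ⟦ server (dual A ∷ []) copy ⟧P (n , bs , tt) ⇔ Permutation (Eq (L A ⅋ `1)) (map g bs) n
  server⇔map = Lift-graph {C = L A ⅋ `1} g g-resp
               ⇔-∘ (Lift-transpose {S = L A ⅋ `1} ⇔-∘ server-sem copy R-resp copy-sem)
Tr-sem (`? A) = Lift-graph {C = C} h h-resp ⇔-∘ server-sem copy (Eq-trans C) copy-sem
  where
  C : Ty
  C = (L A ⅋ `1) ⊗ `⊥
  h : ⟦ dual A ⟧ → ⟦ C ⟧
  h b = (Fdual A b , tt) , tt
  h-resp : ∀ {b b'} → Eq (dual A) b b' → Eq C (h b) (h b')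
  h-resp b≈b' = (Fdual-resp A b≈b' , tt) , tt
  copy : Proc (dual A ∷ `? C ∷ [])
  copy = exch (swap _ _ refl) (client (out (pad (Tr A)) (wait nil)))
  copy-sem : ∀ {b cs} → ⟦ copy ⟧P (b , cs , tt) ⇔ SingletonShare C (λ b c → Eq C (h b) c) (b , cs , tt)
  copy-sem = client-sem (out (pad (Tr A)) (wait nil)) (padTr-sem A ×-⇔ ⇔-id ⊤) ⇔-∘ swap-sem

∘K-sem : ∀ {Σ₀ Φ Γ} (K : Ctxt Φ Γ) (K' : Ctxt Σ₀ Φ) {X ρ} →
         ⟦ K ∘K K' ⟧K X ρ ⇔ ⟦ K ⟧K (⟦ K' ⟧K X) ρ
∘K-sem hole         K' = ⇔-id _
∘K-sem (cutK K r Q) K' = Σ.congˡ {k = equivalence} (∘K-sem K K' ×-⇔ ⇔-id _)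
∘K-sem (mixK K Q)   K' = ∘K-sem K K' ×-⇔ ⇔-id _

liftK-sem : ∀ {B Φ Γ} (K : Ctxt Φ Γ) {X b ρ} →
            ⟦ liftK {B} K ⟧K X (b , ρ) ⇔ ⟦ K ⟧K (λ σ → X (b , σ)) ρ
liftK-sem hole         = ⇔-id _
liftK-sem (cutK K r Q) = Σ.congˡ {k = equivalence} (liftK-sem K ×-⇔ ⇔-id _)
liftK-sem (mixK K Q)   = liftK-sem K ×-⇔ ⇔-id _

cut-Tr-sem : ∀ A {Δ} {X : Env (A ∷ Δ) → Set} {y σ} →
             ⟦ cutK {Δ = L A ∷ []} hole here (Tr A) ⟧K X (y , σ)
             ⇔ (Σ[ a ∈ ⟦ A ⟧ ] (X (a , σ) × Eq (L A) (F A a) y))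
cut-Tr-sem A {y = y} = Σ.congˡ {k = equivalence} (λ {a} → ⇔-id _ ×-⇔ Tr-sem-flip a)
  where
  Tr-sem-flip : ∀ a → ⟦ Tr A ⟧P (flip A a , y , tt) ⇔ Eq (L A) (F A a) y
  Tr-sem-flip a = subst (λ z → ⟦ Tr A ⟧P (flip A a , y , tt) ⇔ Eq (L A) z y) (Fdual-flip A a) (Tr-sem A)

cuts-sem : (Δ : Ctx) (X : Env Δ → Set) (v : Env (map L Δ ++ `1 ∷ [])) →
           ⟦ cuts Δ ⟧K X (proj₁ (split (map L Δ) v)) ⇔ FΔImg Δ X v
cuts-sem []      X v = mk⇔ (λ x → _ , x , _) (λ (_ , x , _) → x)
cuts-sem (A ∷ Δ) X (y , v) = begin
  ⟦ liftK (cuts Δ) ∘K cut₁ ⟧K X (y , w)      ∼⟨ ∘K-sem (liftK (cuts Δ)) cut₁ ⟩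
  ⟦ liftK (cuts Δ) ⟧K (⟦ cut₁ ⟧K X) (y , w)  ∼⟨ liftK-sem (cuts Δ) ⟩
  ⟦ cuts Δ ⟧K (λ σ → ⟦ cut₁ ⟧K X (y , σ)) w  ∼⟨ cuts-sem Δ _ v ⟩
  FΔImg Δ (λ σ → ⟦ cut₁ ⟧K X (y , σ)) v
    ∼⟨ Σ.congˡ {k = equivalence} (λ {u} → cut-Tr-sem A {X = X} {σ = u} ×-⇔ ⇔-id _) ⟩
  (Σ[ u ∈ Env Δ ] ((Σ[ a ∈ ⟦ A ⟧ ] (X (a , u) × Eq (L A) (F A a) y)) × EnvEq _ (FΔ Δ u) v))
    ∼⟨ mk⇔ (λ (u , (a , x , e) , es) → (a , u) , x , e , es)
           (λ ((a , u) , x , e , es) → u , (a , x , e) , es) ⟩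
  FΔImg (A ∷ Δ) X (y , v)                    ∎
  where
  open EquationalReasoning
  w : Env (map L Δ)
  w = proj₁ (split (map L Δ) v)
  cut₁ : Ctxt (A ∷ Δ) (L A ∷ Δ)
  cut₁ = cutK {Δ = L A ∷ []} hole here (Tr A)

theorem32 : (Δ : Ctx) (X : Env Δ → Set) → Closed Δ X →
              (⟦ 𝒯 Δ ⟧K X) ≐ FΔImg Δ X
theorem32 Δ X _ v = cuts-sem Δ X v ⇔-∘ mk⇔ proj₁ (_, tt)
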